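{- Let $G$ and $H$ be connected non complete graphs and consider the corona product graph $G\circ H$. Let $i,j\in\{1,\ldots,n\}$ be distinct. Then $$WT_{G\circ H}(g_i,g_j)=WT_G(g_i,g_j)\cup\bigcup_{k\in A}V(H^k),$$ where $A=\{k\in\{1,\ldots,n\}: k\neq i,\ k\neq j,\ g_k\in WT_G(g_i,g_j)\}$.
   Context: All graphs are finite, simple, connected and have at least two vertices. For vertices $u,v$ of a graph $G$, a weakly toll walk between $u$ and $v$ is a sequence $u=w_0,w_1,\ldots,w_k=v$ ($k\ge 0$) such that, when $k>0$: $w_iw_{i+1}\in E(G)$ for all $i\in\{0,\ldots,k-1\}$; $uw_i\in E(G)$ with $i\in\{1,\ldots,k\}$ implies $w_i=w_1$; and $w_iv\in E(G)$ with $i\in\{0,\ldots,k-1\}$ implies $w_i=w_{k-1}$. $WT_G(u,v)$ is the set of vertices lying on some weakly toll walk between $u$ and $v$. Let $V(G)=\{g_1,\ldots,g_n\}$ and $V(H)=\{h_1,\ldots,h_m\}$. The corona product $G\circ H$ consists of $G$ together with $n$ disjoint copies $H^1,\ldots,H^n$ of $H$, $V(H^i)=\{h_1^i,\ldots,h_m^i\}$, with additional edges $g_ih_j^i$ for all $i,j$. -}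

module Defs where

open import Data.Nat using (ℕ; zero; suc; _≤_; _<_; _∸_)
open import Data.Fin using (Fin)
open import Data.Product using (Σ; ∃; ∃-syntax; _×_; _,_)
open import Data.Sum using (_⊎_; inj₁; inj₂)
open import Data.Empty using (⊥)
open import Relation.Nullary using (¬_)
open import Relation.Binary.PropositionalEquality using (_≡_; _≢_)

record Graph (n : ℕ) : Set₁ where
  field
    Adj   : Fin n → Fin n → Set
    sym   : ∀ {x y} → Adj x y → Adj y x
    irrefl : ∀ {x} → ¬ Adj x x
open Graph public

-- Weakly toll walks for an arbitrary adjacency relation on a vertex type V.
-- A walk w_0,...,w_k is given by its length k and a function w : ℕ → V
-- (only the values w 0, ..., w k matter).
record WTWalk {V : Set} (E : V → V → Set) (u v : V) : Set where
  field
    len   : ℕ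
    w     : ℕ → V
    start : w 0 ≡ u
    end   : w len ≡ v
    step  : ∀ i → i < len → E (w i) (w (suc i))
    tollˡ : 0 < len → ∀ i → 1 ≤ i → i ≤ len → E u (w i) → w i ≡ w 1
    tollʳ : 0 < len → ∀ i → i < len → E (w i) v → w i ≡ w (len ∸ 1)

WTset : {V : Set} (E : V → V → Set) (u v : V) → V → Set
WTset E u v x = Σ (WTWalk E u v) λ W → ∃[ i ] (i ≤ WTWalk.len W × WTWalk.w W i ≡ x)

data Walk {V : Set} (E : V → V → Set) : V → V → Set where
  here  : ∀ {x} → Walk E x x
  there : ∀ {x y z} → E x y → Walk E y z → Walk E x z

Connected : ∀ {n} → Graph n → Set
Connected G = ∀ x y → Walk (Adj G) x y

NonComplete : ∀ {n} → Graph n → Set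
NonComplete G = ∃[ x ] ∃[ y ] (x ≢ y × ¬ Adj G x y)

-- Corona product G ∘ H. Vertex g_i is inj₁ i; vertex h_j^i is inj₂ (i , j).
CoronaV : ℕ → ℕ → Set
CoronaV n m = Fin n ⊎ (Fin n × Fin m)

CoronaAdj : ∀ {n m} → Graph n → Graph m → CoronaV n m → CoronaV n m → Set
CoronaAdj G H (inj₁ a) (inj₁ b) = Adj G a b
CoronaAdj G H (inj₁ a) (inj₂ (b , y)) = a ≡ b
CoronaAdj G H (inj₂ (a , x)) (inj₁ b) = a ≡ b
CoronaAdj G H (inj₂ (a , x)) (inj₂ (b , y)) = a ≡ b × Adj H x y

RHS : ∀ {n m} → Graph n → Fin n → Fin n → CoronaV n m → Set
RHS G i j (inj₁ g) = WTset (Adj G) i j g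
RHS G i j (inj₂ (k , h)) = k ≢ i × k ≢ j × WTset (Adj G) i j k

-- A walk is weakly toll exactly when each end vertex has at most one neighbour on it
-- (that neighbour is then w_1, resp. w_(k-1)).
-- Mapping h^k_x to g_k sends a weakly toll g_i-g_j walk of G∘H to a walk of G with repeated
-- vertices; deleting the repetitions gives a weakly toll walk of G through the image of every
-- visited vertex, because H^k can only be entered through g_k, so a G-neighbour of g_i in the
-- image is the image of a corona neighbour of g_i. The walk cannot meet H^i: if it did, the
-- unique neighbour of g_i on it would lie in H^i and the walk could never leave g_i ∪ H^i;
-- likewise for H^j. Conversely, a weakly toll walk of G through g_k with k ≠ i, j stays weakly
-- toll in G∘H after inserting the excursion g_k, h^k_x, g_k, as h^k_x is adjacent to neither
-- g_i nor g_j.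
module Submission where

open import Defs hiding (sym)
open import Data.Nat using (ℕ; zero; suc; _≤_; _<_; _∸_; z≤n; s≤s)
open import Data.Nat.Properties using (<⇒≤; m<n⇒0<n; m≤n⇒m<n∨m≡n; ≤-reflexive; m∸n≤m; ≤-refl)
open import Data.Fin using (Fin)
open import Data.Product using (Σ-syntax; ∃-syntax; _×_; _,_)
open import Data.Sum using (_⊎_; inj₁; inj₂)
open import Data.Sum.Properties using (inj₁-injective)
open import Data.Empty using (⊥-elim)
open import Function using (_∘_; id; _⇔_; mk⇔; Equivalence)
open import Relation.Nullary using (¬_)
open import Relation.Unary using (_⊆_; _∪_; ｛_｝)
open import Relation.Binary.Definitions using (Symmetric)
open import Relation.Binary.Construct.Closure.Reflexive using (ReflClosure; [_])
  renaming (refl to stay)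
open import Relation.Binary.PropositionalEquality using (_≡_; _≢_; refl; sym; trans; cong; subst)

private
  variable
    V W : Set
    E F : V → V → Set
    a b c d u v x : V

record SeqWalk {V : Set} (E : V → V → Set) (u v : V) : Set where
  field
    len   : ℕ
    w     : ℕ → V
    start : w 0 ≡ u
    end   : w len ≡ v
    step  : ∀ i → i < len → E (w i) (w (suc i))
open SeqWalk

Image≤ : ℕ → (ℕ → V) → V → Set
Image≤ L p x = ∃[ t ] (t ≤ L × p t ≡ x)

Visits : {V : Set} {E : V → V → Set} {u v : V} → SeqWalk E u v → V → Set
Visits P = Image≤ (len P) (w P)

record AtMostOneNeighbour (N : V → V → Set) (x : V) (S : V → Set) : Set where
  constructor atMostOne
  field unique : ∀ {y z} → S y → S z → N x y → N x z → y ≡ z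
open AtMostOneNeighbour

WeaklyToll : SeqWalk E u v → Set
WeaklyToll {E = E} {u} {v} P = AtMostOneNeighbour E u (Visits P) × AtMostOneNeighbour E v (Visits P)

AtMostOneNeighbour-⊆ : {S T : V → Set} → T ⊆ S →
  AtMostOneNeighbour F x S → AtMostOneNeighbour F x T
AtMostOneNeighbour-⊆ T⊆S S-unique = atMostOne λ ty tz → unique S-unique (T⊆S ty) (T⊆S tz)

AtMostOneNeighbour-∪ : {S : V → Set} → ¬ F x d →
  AtMostOneNeighbour F x S → AtMostOneNeighbour F x (｛ d ｝ ∪ S)
AtMostOneNeighbour-∪ {F = F} {x} {d} {S} ¬xd S-unique = atMostOne unique′
  where
    unique′ : ∀ {y z} → (｛ d ｝ ∪ S) y → (｛ d ｝ ∪ S) z → F x y → F x z → y ≡ z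
    unique′ (inj₁ refl) _           xy _  = ⊥-elim (¬xd xy)
    unique′ (inj₂ _)    (inj₁ refl) _  xz = ⊥-elim (¬xd xz)
    unique′ (inj₂ sy)   (inj₂ sz)         = unique S-unique sy sz

module _ (E-sym : Symmetric E) (E-irrefl : ∀ {x} → ¬ E x x) where

  fromWTWalk : WTWalk E u v → SeqWalk E u v
  fromWTWalk P = record { WTWalk P }

  fromWTWalk-weaklyToll : (P : WTWalk E u v) → WeaklyToll (fromWTWalk P)
  fromWTWalk-weaklyToll {u = u} {v} P =
      atMostOne (λ vy vz uy uz → trans (towardsStart vy uy) (sym (towardsStart vz uz)))
    , atMostOne (λ vy vz vy′ vz′ → trans (towardsEnd vy vy′) (sym (towardsEnd vz vz′)))
    where
      Q : SeqWalk E u v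
      Q = fromWTWalk P
      towardsStart : Visits Q x → E u x → x ≡ w Q 1
      towardsStart (zero  , _  , refl) ux = ⊥-elim (E-irrefl (subst (E u) (start Q) ux))
      towardsStart (suc t , le , refl) ux = WTWalk.tollˡ P (m<n⇒0<n le) (suc t) (s≤s z≤n) le ux
      towardsEnd : Visits Q x → E v x → x ≡ w Q (len Q ∸ 1)
      towardsEnd (t , le , refl) vx with m≤n⇒m<n∨m≡n le
      ... | inj₁ lt   = WTWalk.tollʳ P (m<n⇒0<n lt) t lt (E-sym vx)
      ... | inj₂ refl = ⊥-elim (E-irrefl (subst (E v) (end Q) vx))

  toWTWalk : (P : SeqWalk E u v) → WeaklyToll P → WTWalk E u v
  toWTWalk {u = u} {v} P (atMostOne uniqueˡ , atMostOne uniqueʳ) = record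
    { SeqWalk P
    ; tollˡ = λ pos i _ le ui →
        uniqueˡ (i , le , refl) (1 , pos , refl) ui
                (subst (λ z → E z (w P 1)) (start P) (step P 0 pos))
    ; tollʳ = λ pos i lt iv →
        uniqueʳ (i , <⇒≤ lt , refl) (len P ∸ 1 , ∸1≤ , refl) (E-sym iv) (E-sym (lastStep pos))
    }
    where
      suc-∸1 : ∀ {n} → 0 < n → suc (n ∸ 1) ≡ n
      suc-∸1 {suc n} _ = refl
      ∸1≤ : len P ∸ 1 ≤ len P
      ∸1≤ = m∸n≤m (len P) 1
      lastStep : 0 < len P → E (w P (len P ∸ 1)) v
      lastStep pos = subst (E (w P (len P ∸ 1))) (trans (cong (w P) (suc-∸1 pos)) (end P))
                       (step P (len P ∸ 1) (≤-reflexive (suc-∸1 pos)))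

  WTset⇔weaklyToll : WTset E u v x ⇔ (Σ[ P ∈ SeqWalk E u v ] (WeaklyToll P × Visits P x))
  WTset⇔weaklyToll = mk⇔ (λ (P , vx) → fromWTWalk P , fromWTWalk-weaklyToll P , vx)
                         (λ (P , toll , vx) → toWTWalk P toll , vx)

module Map {E : V → V → Set} {F : W → W → Set}
           (f : V → W) (hom : ∀ x y → E x y → F (f x) (f y)) where

  map : SeqWalk E u v → SeqWalk F (f u) (f v)
  map P = record
    { len = len P ; w = f ∘ w P ; start = cong f (start P) ; end = cong f (end P)
    ; step = λ i lt → hom (w P i) (w P (suc i)) (step P i lt) }

  map-visits : (P : SeqWalk E u v) → Visits P x → Visits (map P) (f x)
  map-visits P (t , le , refl) = t , le , refl

  map-visits⁻ : (P : SeqWalk E u v) → ∀ {y} → Visits (map P) y → ∃[ x ] (Visits P x × f x ≡ y)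
  map-visits⁻ P (t , le , refl) = w P t , (t , le , refl) , refl

  map-atMostOneNeighbour : (∀ {x y} → F (f x) (f y) → E x y) → (P : SeqWalk E u v) →
    AtMostOneNeighbour E x (Visits P) → AtMostOneNeighbour F (f x) (Visits (map P))
  map-atMostOneNeighbour {x = x} reflect P P-unique = atMostOne unique′
    where
      unique′ : ∀ {y z} → Visits (map P) y → Visits (map P) z → F (f x) y → F (f x) z → y ≡ z
      unique′ (s , ls , refl) (t , lt , refl) xs xt =
        cong f (unique P-unique (s , ls , refl) (t , lt , refl) (reflect xs) (reflect xt))

fromSeq : ∀ L (p : ℕ → V) → (∀ i → i < L → E (p i) (p (suc i))) → SeqWalk E (p 0) (p L)
fromSeq L p st = record { len = L ; w = p ; start = refl ; end = refl ; step = st }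

_◂_ : V → (ℕ → V) → ℕ → V
(a ◂ p) zero    = a
(a ◂ p) (suc t) = p t

prepend : E a b → SeqWalk E b c → SeqWalk E a c
prepend {E = E} {a = a} ab P = record
  { len = suc (len P) ; w = a ◂ w P ; start = refl ; end = end P ; step = step′ }
  where
    step′ : ∀ i → i < suc (len P) → E ((a ◂ w P) i) ((a ◂ w P) (suc i))
    step′ zero    _       = subst (E a) (sym (start P)) ab
    step′ (suc i) (s≤s lt) = step P i lt

module _ (ab : E a b) (P : SeqWalk E b c) where

  prepend-visits-head : Visits (prepend ab P) a
  prepend-visits-head = 0 , z≤n , refl

  prepend-visits-tail : Visits P ⊆ Visits (prepend ab P)
  prepend-visits-tail (t , le , eq) = suc t , s≤s le , eq

  prepend-visits⁻ : Visits (prepend ab P) ⊆ ｛ a ｝ ∪ Visits P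
  prepend-visits⁻ (zero  , _      , eq) = inj₁ eq
  prepend-visits⁻ (suc t , s≤s le , eq) = inj₂ (t , le , eq)

prepend? : ReflClosure E a b → SeqWalk E b c → SeqWalk E a c
prepend? stay   P = P
prepend? [ ab ] P = prepend ab P

prepend?-visits-head : (ab : ReflClosure E a b) (P : SeqWalk E b c) → Visits (prepend? ab P) a
prepend?-visits-head stay   P = 0 , z≤n , start P
prepend?-visits-head [ ab ] P = prepend-visits-head ab P

prepend?-visits-tail : (ab : ReflClosure E a b) (P : SeqWalk E b c) →
  Visits P ⊆ Visits (prepend? ab P)
prepend?-visits-tail stay   P vx = vx
prepend?-visits-tail [ ab ] P vx = prepend-visits-tail ab P vx

prepend?-visits⁻ : (ab : ReflClosure E a b) (P : SeqWalk E b c) →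
  Visits (prepend? ab P) ⊆ ｛ a ｝ ∪ Visits P
prepend?-visits⁻ stay   P vx = inj₂ vx
prepend?-visits⁻ [ ab ] P vx = prepend-visits⁻ ab P vx

retarget : a ≡ u → b ≡ v → SeqWalk E a b → SeqWalk E u v
retarget au bv P = record
  { len = len P ; w = w P ; start = trans (start P) au ; end = trans (end P) bv ; step = step P }

compressSeq : ∀ L (p : ℕ → V) → (∀ i → i < L → ReflClosure E (p i) (p (suc i))) →
  Σ[ Q ∈ SeqWalk E (p 0) (p L) ] (Visits Q ⊆ Image≤ L p × Image≤ L p ⊆ Visits Q)
compressSeq zero    p st = fromSeq 0 p (λ _ ()) , (λ vx → vx) , (λ vx → vx)
compressSeq {E = E} (suc L) p st with compressSeq L (p ∘ suc) (λ i lt → st (suc i) (s≤s lt))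
... | Q , ⊆p , ⊇p = prepend? first Q , sub , sup
  where
    first : ReflClosure E (p 0) (p 1)
    first = st 0 (s≤s z≤n)
    sub : Visits (prepend? first Q) ⊆ Image≤ (suc L) p
    sub vx with prepend?-visits⁻ first Q vx
    ... | inj₁ eq = 0 , z≤n , eq
    ... | inj₂ vq with ⊆p vq
    ...   | t , le , eq = suc t , s≤s le , eq
    sup : Image≤ (suc L) p ⊆ Visits (prepend? first Q)
    sup (zero  , _      , refl) = prepend?-visits-head first Q
    sup (suc t , s≤s le , eq)   = prepend?-visits-tail first Q (⊇p (t , le , eq))

compress : (P : SeqWalk (ReflClosure E) u v) →
  Σ[ Q ∈ SeqWalk E u v ] (Visits Q ⊆ Visits P × Visits P ⊆ Visits Q)
compress P with compressSeq (len P) (w P) (step P)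
... | Q , ⊆P , ⊇P = retarget (start P) (end P) Q , ⊆P , ⊇P

detourSeq : ∀ L t (p : ℕ → V) → t ≤ L → (∀ i → i < L → E (p i) (p (suc i))) →
  E (p t) d → E d (p t) →
  Σ[ Q ∈ SeqWalk E (p 0) (p L) ] (Visits Q d × Visits Q ⊆ ｛ d ｝ ∪ Image≤ L p)
detourSeq {E = E} {d = d} L zero p _ st out back =
    prepend out (prepend back P)
  , prepend-visits-tail out (prepend back P) (prepend-visits-head back P)
  , sub
  where
    P : SeqWalk E (p 0) (p L)
    P = fromSeq L p st
    sub : Visits (prepend out (prepend back P)) ⊆ ｛ d ｝ ∪ Image≤ L p
    sub vx with prepend-visits⁻ out (prepend back P) vx
    ... | inj₁ eq = inj₂ (0 , z≤n , eq)
    ... | inj₂ vx′ = prepend-visits⁻ back P vx′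
detourSeq {E = E} {d = d} (suc L) (suc t) p (s≤s le) st out back
  with detourSeq L t (p ∘ suc) le (λ i lt → st (suc i) (s≤s lt)) out back
... | Q , dQ , ⊆Q = prepend first Q , prepend-visits-tail first Q dQ , sub
  where
    first : E (p 0) (p 1)
    first = st 0 (s≤s z≤n)
    sub : Visits (prepend first Q) ⊆ ｛ d ｝ ∪ Image≤ (suc L) p
    sub vx with prepend-visits⁻ first Q vx
    ... | inj₁ eq = inj₂ (0 , z≤n , eq)
    ... | inj₂ vq with ⊆Q vq
    ...   | inj₁ eq           = inj₁ eq
    ...   | inj₂ (t , le , eq) = inj₂ (suc t , s≤s le , eq)

detour : (P : SeqWalk E u v) → Visits P c → E c d → E d c →
  Σ[ Q ∈ SeqWalk E u v ] (Visits Q d × Visits Q ⊆ ｛ d ｝ ∪ Visits P)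
detour P (t , le , refl) out back with detourSeq (len P) t (w P) le (step P) out back
... | Q , dQ , ⊆Q = retarget (start P) (end P) Q , dQ , ⊆Q

closed⇒endpoints⇔ : Symmetric E → (P : SeqWalk E u v) → {I : V → Set} →
  (∀ {y z} → Visits P y → Visits P z → E y z → I y → I z) → I u ⇔ I v
closed⇒endpoints⇔ {E = E} {u} E-sym P {I} closed with reach (len P) ≤-refl
  where
    reach : ∀ t → t ≤ len P → (I u → I (w P t)) × (I (w P t) → I u)
    reach zero    _  = subst I (sym (start P)) , subst I (start P)
    reach (suc t) lt with reach t (<⇒≤ lt)
    ... | to , from = (λ cu → closed current next (step P t lt) (to cu))
                    , (λ cs → from (closed next current (E-sym (step P t lt)) cs))
      where
        current : Visits P (w P t)
        current = t , <⇒≤ lt , refl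
        next : Visits P (w P (suc t))
        next = suc t , lt , refl
... | to , from = mk⇔ (subst I (end P) ∘ to) (from ∘ subst I (sym (end P)))

module Corona {n m : ℕ} (G : Graph n) (H : Graph m) where

  C : CoronaV n m → CoronaV n m → Set
  C = CoronaAdj G H

  C-sym : Symmetric C
  C-sym {inj₁ _} {inj₁ _} e       = Graph.sym G e
  C-sym {inj₁ _} {inj₂ _} e       = sym e
  C-sym {inj₂ _} {inj₁ _} e       = sym e
  C-sym {inj₂ _} {inj₂ _} (e , h) = sym e , Graph.sym H h

  C-irrefl : ∀ {x} → ¬ C x x
  C-irrefl {inj₁ _} = Graph.irrefl G
  C-irrefl {inj₂ _} (_ , h) = Graph.irrefl H h

  root : CoronaV n m → Fin n
  root (inj₁ a)       = a
  root (inj₂ (a , _)) = a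

  root-step : ∀ x y → C x y → ReflClosure (Adj G) (root x) (root y)
  root-step (inj₁ _) (inj₁ _) e          = [ e ]
  root-step (inj₁ _) (inj₂ _) refl       = stay
  root-step (inj₂ _) (inj₁ _) refl       = stay
  root-step (inj₂ _) (inj₂ _) (refl , _) = stay

  module Project = Map {F = ReflClosure (Adj G)} root root-step

  step-into-fibre : ∀ {x k h} → C x (inj₂ (k , h)) → root x ≡ k
  step-into-fibre {inj₁ _} e       = e
  step-into-fibre {inj₂ _} (e , _) = e

  -- A walk from a vertex of G can only enter the copy H^k through g_k.
  visits-root : {i : Fin n} {v : CoronaV n m} (P : SeqWalk C (inj₁ i) v) →
    ∀ {x} → Visits P x → Visits P (inj₁ (root x))
  visits-root P (t , le , refl) = reach t le
    where
      reach : ∀ t → t ≤ len P → Visits P (inj₁ (root (w P t)))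
      reach zero    _  = 0 , z≤n , trans (start P) (sym (cong (inj₁ ∘ root) (start P)))
      reach (suc t) lt with w P (suc t) in eq
      ... | inj₁ a       = suc t , lt , eq
      ... | inj₂ (k , h) = subst (λ r → Visits P (inj₁ r))
                             (step-into-fibre {w P t} (subst (C (w P t)) eq (step P t lt)))
                             (reach t (<⇒≤ lt))

  root-atMostOneNeighbour : ∀ {i a v} (P : SeqWalk C (inj₁ i) v) →
    AtMostOneNeighbour C (inj₁ a) (Visits P) → AtMostOneNeighbour (Adj G) a (Visits (Project.map P))
  root-atMostOneNeighbour {a = a} P P-unique = atMostOne unique′
    where
      unique′ : ∀ {y z} → Visits (Project.map P) y → Visits (Project.map P) z →
        Adj G a y → Adj G a z → y ≡ z
      unique′ vy vz ay az with Project.map-visits⁻ P vy | Project.map-visits⁻ P vz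
      ... | _ , vx , refl | _ , vx′ , refl =
        inj₁-injective (unique P-unique (visits-root P vx) (visits-root P vx′) ay az)

  toGraphWalk : ∀ {i j} (P : SeqWalk C (inj₁ i) (inj₁ j)) → WeaklyToll P →
    Σ[ Q ∈ SeqWalk (Adj G) i j ] (WeaklyToll Q × ∀ {x} → Visits P x → Visits Q (root x))
  toGraphWalk P (tollˡ , tollʳ) with compress (Project.map P)
  ... | Q , ⊆P , ⊇P =
    Q , ( AtMostOneNeighbour-⊆ ⊆P (root-atMostOneNeighbour P tollˡ)
        , AtMostOneNeighbour-⊆ ⊆P (root-atMostOneNeighbour P tollʳ)) , ⊇P ∘ Project.map-visits P

  -- The walk cannot leave {g_k, h^k}: the only neighbour of g_k on it is h^k, and every
  -- neighbour of h^k is g_k or a neighbour of g_k.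
  visits-fibre : ∀ {i j k h} (P : SeqWalk C (inj₁ i) (inj₁ j)) →
    AtMostOneNeighbour C (inj₁ k) (Visits P) → Visits P (inj₂ (k , h)) → k ≡ i ⇔ k ≡ j
  visits-fibre {i} {j} {k} {h} P P-unique vh
    with closed⇒endpoints⇔ (λ {x} {y} → C-sym {x} {y}) P closed
    where
      Trap : CoronaV n m → Set
      Trap x = inj₁ k ≡ x ⊎ inj₂ (k , h) ≡ x
      closed : ∀ {y z} → Visits P y → Visits P z → C y z → Trap y → Trap z
      closed                 _ vz e          (inj₁ refl) = inj₂ (unique P-unique vh vz refl e)
      closed {z = inj₁ _}    _ _  refl       (inj₂ refl) = inj₁ refl
      closed {z = inj₂ _}    _ vz (refl , _) (inj₂ refl) = inj₂ (unique P-unique vh vz refl refl)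
  ... | trapped = mk⇔ (λ k≡i → fromTrap (Equivalence.to trapped (inj₁ (cong inj₁ k≡i))))
                      (λ k≡j → fromTrap (Equivalence.from trapped (inj₁ (cong inj₁ k≡j))))
    where
      fromTrap : ∀ {a} → inj₁ k ≡ inj₁ a ⊎ inj₂ (k , h) ≡ inj₁ a → k ≡ a
      fromTrap (inj₁ eq) = inj₁-injective eq
      fromTrap (inj₂ ())

  module Lift = Map {F = C} inj₁ (λ _ _ e → e)

  lift-weaklyToll : ∀ {i j} (Q : SeqWalk (Adj G) i j) → WeaklyToll Q → WeaklyToll (Lift.map Q)
  lift-weaklyToll Q (tollˡ , tollʳ) =
    Lift.map-atMostOneNeighbour id Q tollˡ , Lift.map-atMostOneNeighbour id Q tollʳ

  walkThroughFibre : ∀ {i j k} h → k ≢ i → k ≢ j →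
    (Q : SeqWalk (Adj G) i j) → WeaklyToll Q → Visits Q k →
    Σ[ P ∈ SeqWalk C (inj₁ i) (inj₁ j) ] (WeaklyToll P × Visits P (inj₂ (k , h)))
  walkThroughFibre h k≢i k≢j Q toll vk
    with lift-weaklyToll Q toll | detour (Lift.map Q) (Lift.map-visits Q vk) refl refl
  ... | tollˡ , tollʳ | P , vh , ⊆Q =
    P , ( AtMostOneNeighbour-⊆ ⊆Q (AtMostOneNeighbour-∪ (k≢i ∘ sym) tollˡ)
        , AtMostOneNeighbour-⊆ ⊆Q (AtMostOneNeighbour-∪ (k≢j ∘ sym) tollʳ)) , vh

  C-WTset⇔ : ∀ {u v x} → WTset C u v x ⇔ (Σ[ P ∈ SeqWalk C u v ] (WeaklyToll P × Visits P x))
  C-WTset⇔ = WTset⇔weaklyToll (λ {x} {y} → C-sym {x} {y}) (λ {x} → C-irrefl {x})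

  G-WTset⇔ : ∀ {i j a} →
    WTset (Adj G) i j a ⇔ (Σ[ Q ∈ SeqWalk (Adj G) i j ] (WeaklyToll Q × Visits Q a))
  G-WTset⇔ = WTset⇔weaklyToll (Graph.sym G) (Graph.irrefl G)

  WTset-root : ∀ {i j x} (P : SeqWalk C (inj₁ i) (inj₁ j)) → WeaklyToll P → Visits P x →
    WTset (Adj G) i j (root x)
  WTset-root P toll vx with toGraphWalk P toll
  ... | Q , tollQ , onQ = Equivalence.from G-WTset⇔ (Q , tollQ , onQ vx)

  weaklyToll⇒RHS : ∀ {i j} → i ≢ j → (P : SeqWalk C (inj₁ i) (inj₁ j)) → WeaklyToll P →
    ∀ {x} → Visits P x → RHS G i j x
  weaklyToll⇒RHS _ P toll {inj₁ _} vg = WTset-root P toll vg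
  weaklyToll⇒RHS i≢j P toll@(tollˡ , tollʳ) {inj₂ _} vh =
      (λ { refl → i≢j (Equivalence.to (visits-fibre P tollˡ vh) refl) })
    , (λ { refl → i≢j (sym (Equivalence.from (visits-fibre P tollʳ vh) refl)) })
    , WTset-root P toll vh

  RHS⇒WTset : ∀ {i j} x → RHS G i j x → WTset C (inj₁ i) (inj₁ j) x
  RHS⇒WTset (inj₁ _) wt with Equivalence.to G-WTset⇔ wt
  ... | Q , toll , vg =
    Equivalence.from C-WTset⇔ (Lift.map Q , lift-weaklyToll Q toll , Lift.map-visits Q vg)
  RHS⇒WTset (inj₂ (_ , h)) (k≢i , k≢j , wt) with Equivalence.to G-WTset⇔ wt
  ... | Q , toll , vk = Equivalence.from C-WTset⇔ (walkThroughFibre h k≢i k≢j Q toll vk)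

mainTheorem15 : ∀ {n m} (G : Graph n) (H : Graph m) →
    Connected G → Connected H → NonComplete G → NonComplete H →
    (i j : Fin n) → i ≢ j →
    ∀ (x : CoronaV n m) → WTset (CoronaAdj G H) (inj₁ i) (inj₁ j) x ⇔ RHS G i j x
mainTheorem15 G H _ _ _ _ i j i≢j x = mk⇔ forward (RHS⇒WTset x)
  where
    open Corona G H
    forward : WTset C (inj₁ i) (inj₁ j) x → RHS G i j x
    forward wt with Equivalence.to C-WTset⇔ wt
    ... | P , toll , vx = weaklyToll⇒RHS i≢j P toll vx
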